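{- Every graph with average degree $d$, maximum degree $\Delta\geq 3$ and diameter $k$ has at most $2d(\Delta-1)^{k-1}+1$ vertices. -}

module Defs where

open import Data.Nat using (ℕ; zero; suc; _+_; _≤_; _<_; NonZero)
open import Data.Fin using (Fin)
open import Data.Bool using (Bool; true; false; if_then_else_)
open import Data.List using (List; map; allFin)
open import Data.Nat.ListAction using (sum)
open import Data.Product using (Σ; ∃; _×_; _,_)
open import Relation.Binary.PropositionalEquality using (_≡_)
open import Relation.Nullary using (¬_)
open import Data.Integer using (+_)
open import Data.Rational.Unnormalised using (ℚᵘ; _/_)

record Graph (n : ℕ) : Set where
  field
    adj     : Fin n → Fin n → Bool
    symm    : ∀ i j → adj i j ≡ adj j i
    irrefl  : ∀ i → adj i i ≡ false
open Graph public

degree : ∀ {n} → Graph n → Fin n → ℕ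
degree {n} G i = sum (map (λ j → if adj G i j then 1 else 0) (allFin n))

degreeSum : ∀ {n} → Graph n → ℕ
degreeSum {n} G = sum (map (degree G) (allFin n))

averageDegree : ∀ {n} .{{_ : NonZero n}} → Graph n → ℚᵘ
averageDegree {n} G = (+ degreeSum G) / n

IsMaxDegree : ∀ {n} → Graph n → ℕ → Set
IsMaxDegree {n} G Δ = (∀ i → degree G i ≤ Δ) × ∃ λ i → degree G i ≡ Δ

data Walk {n : ℕ} (G : Graph n) : Fin n → Fin n → ℕ → Set where
  here  : ∀ {i} → Walk G i i 0
  step  : ∀ {i j l m} → adj G i j ≡ true → Walk G j l m → Walk G i l (suc m)

DistLe : ∀ {n} → Graph n → Fin n → Fin n → ℕ → Set
DistLe G i j m = ∃ λ l → l ≤ m × Walk G i j l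

IsDiameter : ∀ {n} → Graph n → ℕ → Set
IsDiameter {n} G k =
  (∀ i j → DistLe G i j k) ×
  (∃ λ i → ∃ λ j → ∀ l → l < k → ¬ Walk G i j l)

module Submission where

-- Fix a vertex v and grow the ball around it one step at a time. Each vertex of the next
-- sphere is an outward neighbour of a vertex of the current one. The first sphere has at most
-- deg v vertices, and a vertex of any later sphere has a neighbour one step closer to v, hence
-- at most Δ − 1 outward neighbours; so the l-th sphere has at most deg v · (Δ − 1)^(l−1)
-- vertices. Since Δ − 1 ≥ 2, the ball of radius k ≥ 1 has at most 2 deg v (Δ − 1)^(k−1) + 1
-- vertices, and diameter k makes it the whole graph. Summing this bound over all v gives
-- n² ≤ 2 (Σ deg v) (Δ − 1)^(k−1) + n, which is the claim times n.

open import Defs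
open import Data.Fin using (Fin)

module Counting where

  open import Data.Bool using (Bool; true; false; _∧_; _∨_; not; if_then_else_)
  open import Data.Fin using (zero; suc; _≟_)
  open import Data.List using (map; allFin; tabulate)
  open import Data.List.Properties using (map-tabulate)
  import Data.Nat.ListAction as List
  open import Data.Nat hiding (_≟_)
  open import Data.Nat.Properties hiding (_≟_)
  open import Function using (_∘_; id)
  open import Data.Product using (∃; _,_)
  open import Relation.Binary.PropositionalEquality
  open import Relation.Nullary.Decidable using (does)

  open import Algebra.Properties.Semiring.Sum +-*-semiring public
    using (sum; ∑-distrib-+; ∑-comm; *-distribˡ-sum; *-distribʳ-sum; sum-cong-≗)
  open import Algebra.Properties.Semiring.Sum +-*-semiring
    using (sum-replicate-zero)

  sum-mono-≤ : ∀ {n} {f g : Fin n → ℕ} → (∀ i → f i ≤ g i) → sum f ≤ sum g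
  sum-mono-≤ {zero}  _   = z≤n
  sum-mono-≤ {suc n} f≤g = +-mono-≤ (f≤g zero) (sum-mono-≤ (f≤g ∘ suc))

  ≤-sum : ∀ {n} (f : Fin n → ℕ) i → f i ≤ sum f
  ≤-sum f zero    = m≤m+n _ _
  ≤-sum f (suc i) = ≤-trans (≤-sum (f ∘ suc) i) (m≤n+m _ _)

  sum-const : ∀ n c → sum {n} (λ _ → c) ≡ n * c
  sum-const zero    c = refl
  sum-const (suc n) c = cong (c +_) (sum-const n c)

  sum-allFin : ∀ {n} (f : Fin n → ℕ) → List.sum (map f (allFin n)) ≡ sum f
  sum-allFin {n} f = trans (cong List.sum (map-tabulate id f)) (sum-tabulate f)
    where
    sum-tabulate : ∀ {m} (g : Fin m → ℕ) → List.sum (tabulate g) ≡ sum g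
    sum-tabulate {zero}  g = refl
    sum-tabulate {suc m} g = cong (g zero +_) (sum-tabulate (g ∘ suc))

  𝟙 : Bool → ℕ
  𝟙 b = if b then 1 else 0

  count : ∀ {n} → (Fin n → Bool) → ℕ
  count p = sum (λ i → 𝟙 (p i))

  count-split : ∀ {n} (p q : Fin n → Bool) →
                count p ≡ count (λ i → p i ∧ q i) + count (λ i → p i ∧ not (q i))
  count-split p q = trans (sum-cong-≗ (λ i → 𝟙-split (p i) (q i)))
                          (∑-distrib-+ (λ i → 𝟙 (p i ∧ q i)) (λ i → 𝟙 (p i ∧ not (q i))))
    where
    𝟙-split : ∀ a b → 𝟙 a ≡ 𝟙 (a ∧ b) + 𝟙 (a ∧ not b)
    𝟙-split false b     = refl
    𝟙-split true  false = refl
    𝟙-split true  true  = refl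

  count-total : ∀ {n} {p : Fin n → Bool} → (∀ i → p i ≡ true) → count p ≡ n
  count-total {n} all = trans (sum-cong-≗ (λ i → cong 𝟙 (all i))) (trans (sum-const n 1) (*-identityʳ n))

  sum-𝟙≟ : ∀ {n} (v : Fin n) (f : Fin n → ℕ) → sum (λ w → 𝟙 (does (w ≟ v)) * f w) ≡ f v
  sum-𝟙≟ {suc n} zero    f =
    trans (cong₂ _+_ (+-identityʳ (f zero)) (sum-replicate-zero n)) (+-identityʳ (f zero))
  sum-𝟙≟ {suc n} (suc v) f = sum-𝟙≟ v (f ∘ suc)

  anyᶠ : ∀ {n} → (Fin n → Bool) → Bool
  anyᶠ {zero}  p = false
  anyᶠ {suc n} p = p zero ∨ anyᶠ (p ∘ suc)

  anyᶠ⁺ : ∀ {n} (p : Fin n → Bool) w → p w ≡ true → anyᶠ p ≡ true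
  anyᶠ⁺ p zero    pw rewrite pw = refl
  anyᶠ⁺ p (suc w) pw with p zero
  ... | true  = refl
  ... | false = anyᶠ⁺ (p ∘ suc) w pw

  anyᶠ⁻ : ∀ {n} (p : Fin n → Bool) → anyᶠ p ≡ true → ∃ λ w → p w ≡ true
  anyᶠ⁻ {suc n} p any with p zero in p₀
  ... | true  = zero , p₀
  ... | false with anyᶠ⁻ (p ∘ suc) any
  ...   | w , pw = suc w , pw

module Balls {n} (G : Graph n) (v : Fin n) where

  open import Data.Bool using (Bool; true; false; _∧_; _∨_; not)
  open import Data.Bool.Properties using (∧-identityʳ; ∧-zeroʳ; ∧-conicalˡ; ∧-conicalʳ; ∨-zeroʳ)
  open import Data.Fin using (_≟_)
  open import Data.Nat hiding (_≟_)
  open import Data.Nat.Properties hiding (_≟_)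
  open import Data.Product using (∃; _×_; _,_)
  open import Relation.Binary.PropositionalEquality
  open import Relation.Nullary.Decidable using (does; dec-true)
  open import Relation.Nullary.Negation using (contradiction)
  open Counting
  open import Algebra.Properties.CommutativeSemigroup *-commutativeSemigroup using (x∙yz≈y∙xz)
  open import Data.Nat.Tactic.RingSolver using (solve-∀)

  ball : ℕ → Fin n → Bool
  ball zero    u = does (u ≟ v)
  ball (suc l) u = ball l u ∨ anyᶠ (λ w → adj G u w ∧ ball l w)

  sphere : ℕ → Fin n → Bool
  sphere zero      = ball zero
  sphere (suc l) u = ball (suc l) u ∧ not (ball l u)

  ball-adj⁺ : ∀ {l u w} → adj G u w ≡ true → ball l w ≡ true → ball (suc l) u ≡ true
  ball-adj⁺ {l} {u} {w} u~w w∈B =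
    trans (cong (ball l u ∨_) (anyᶠ⁺ _ w (cong₂ _∧_ u~w w∈B))) (∨-zeroʳ (ball l u))

  ball-suc⁺ : ∀ {l u} → ball l u ≡ true → ball (suc l) u ≡ true
  ball-suc⁺ u∈B rewrite u∈B = refl

  ball-mono : ∀ {l m u} → l ≤ m → ball l u ≡ true → ball m u ≡ true
  ball-mono l≤m = go (≤⇒≤′ l≤m)
    where
    go : ∀ {l m u} → l ≤′ m → ball l u ≡ true → ball m u ≡ true
    go ≤′-refl            u∈B = u∈B
    go (≤′-step {m} l≤′m) u∈B = ball-suc⁺ {m} (go l≤′m u∈B)

  walk⇒ball : ∀ {u l} → Walk G u v l → ball l u ≡ true
  walk⇒ball here                     = dec-true (v ≟ v) refl
  walk⇒ball (step {m = l} u~w walk) = ball-adj⁺ {l} u~w (walk⇒ball walk)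

  distLe⇒ball : ∀ {u k} → DistLe G u v k → ball k u ≡ true
  distLe⇒ball (l , l≤k , walk) = ball-mono l≤k (walk⇒ball walk)

  adjacent-outside-ball⇒sphere : ∀ l {u w} → ball l u ≡ false → adj G u w ≡ true →
                                 ball l w ≡ true → sphere l w ≡ true
  adjacent-outside-ball⇒sphere zero            u∉B u~w w∈B = w∈B
  adjacent-outside-ball⇒sphere (suc l) {u} {w} u∉B u~w w∈B with ball l w in w∈B′
  ... | false = trans (∧-identityʳ _) w∈B
  ... | true  = contradiction (trans (sym (ball-adj⁺ {l} u~w w∈B′)) u∉B) λ ()

  sphere-suc⇒ : ∀ l {u} → sphere (suc l) u ≡ true →
                ball l u ≡ false × ∃ λ w → adj G u w ≡ true × ball l w ≡ true
  sphere-suc⇒ l {u} u∈S with ball l u in u∉B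
  ... | false with anyᶠ⁻ _ (trans (sym (∧-identityʳ _)) u∈S)
  ...   | w , u~w∈B = refl , w , ∧-conicalˡ _ _ u~w∈B , ∧-conicalʳ _ _ u~w∈B

  count-ball-zero : count (ball 0) ≡ 1
  count-ball-zero = trans (sum-cong-≗ (λ w → sym (*-identityʳ (𝟙 (ball 0 w))))) (sum-𝟙≟ v (λ _ → 1))

  count-ball-suc : ∀ l → count (ball (suc l)) ≡ count (ball l) + count (sphere (suc l))
  count-ball-suc l = trans (count-split (ball (suc l)) (ball l))
                           (cong (_+ count (sphere (suc l))) (sum-cong-≗ (λ u → cong 𝟙 (ball-suc-∧ u))))
    where
    ball-suc-∧ : ∀ u → ball (suc l) u ∧ ball l u ≡ ball l u
    ball-suc-∧ u with ball l u
    ... | true  = refl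
    ... | false = ∧-zeroʳ _

  outNeighbour : ℕ → Fin n → Fin n → Bool
  outNeighbour l w u = adj G w u ∧ not (ball l u)

  outDegree : ℕ → Fin n → ℕ
  outDegree l w = count (outNeighbour l w)

  degree-split : ∀ l w → degree G w ≡ count (λ u → adj G w u ∧ ball l u) + outDegree l w
  degree-split l w = trans (sum-allFin (λ u → 𝟙 (adj G w u))) (count-split (adj G w) (ball l))

  outDegree≤degree : ∀ l w → outDegree l w ≤ degree G w
  outDegree≤degree l w = ≤-trans (m≤n+m _ _) (≤-reflexive (sym (degree-split l w)))

  outDegree-sphere : ∀ l {w} → sphere (suc l) w ≡ true → outDegree (suc l) w + 1 ≤ degree G w
  outDegree-sphere l {w} w∈S with sphere-suc⇒ l w∈S
  ... | _ , x , w~x , x∈B = begin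
    outDegree (suc l) w + 1                                  ≡⟨ +-comm _ 1 ⟩
    1 + outDegree (suc l) w                                  ≡⟨ cong (_+ outDegree (suc l) w) x-inside ⟨
    inside x + outDegree (suc l) w                           ≤⟨ +-monoˡ-≤ _ (≤-sum inside x) ⟩
    count (λ u → adj G w u ∧ ball (suc l) u) + outDegree (suc l) w ≡⟨ degree-split (suc l) w ⟨
    degree G w                                               ∎
    where
    open ≤-Reasoning
    inside : Fin n → ℕ
    inside u = 𝟙 (adj G w u ∧ ball (suc l) u)
    x-inside : inside x ≡ 1
    x-inside = cong 𝟙 (cong₂ _∧_ w~x (ball-suc⁺ {l} x∈B))

  count-sphere-suc≤ : ∀ l → count (sphere (suc l)) ≤ sum (λ w → 𝟙 (sphere l w) * outDegree l w)
  count-sphere-suc≤ l = begin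
    count (sphere (suc l))                      ≤⟨ sum-mono-≤ reached ⟩
    sum (λ u → sum (λ w → outEdge w u))         ≡⟨ ∑-comm (λ u w → outEdge w u) ⟩
    sum (λ w → sum (λ u → outEdge w u))
      ≡⟨ sum-cong-≗ (λ w → *-distribˡ-sum (𝟙 (sphere l w)) (outEdgeFrom w)) ⟨
    sum (λ w → 𝟙 (sphere l w) * outDegree l w)  ∎
    where
    open ≤-Reasoning
    outEdgeFrom : Fin n → Fin n → ℕ
    outEdgeFrom w u = 𝟙 (outNeighbour l w u)
    outEdge : Fin n → Fin n → ℕ
    outEdge w u = 𝟙 (sphere l w) * outEdgeFrom w u
    reached : ∀ u → 𝟙 (sphere (suc l) u) ≤ sum (λ w → outEdge w u)
    reached u with sphere (suc l) u in u∈S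
    ... | false = z≤n
    ... | true with sphere-suc⇒ l u∈S
    ...   | u∉B , w , u~w , w∈B = ≤-trans (≤-reflexive (sym outEdge≡1)) (≤-sum (λ w → outEdge w u) w)
      where
      outEdge≡1 : outEdge w u ≡ 1
      outEdge≡1 rewrite adjacent-outside-ball⇒sphere l u∉B u~w w∈B | symm G w u | u~w | u∉B = refl

  count-sphere-one≤ : count (sphere 1) ≤ degree G v
  count-sphere-one≤ = begin
    count (sphere 1)                                   ≤⟨ count-sphere-suc≤ 0 ⟩
    sum (λ w → 𝟙 (does (w ≟ v)) * outDegree 0 w)       ≡⟨ sum-𝟙≟ v (outDegree 0) ⟩
    outDegree 0 v                                      ≤⟨ outDegree≤degree 0 v ⟩
    degree G v                                         ∎
    where open ≤-Reasoning

  module _ (Δ : ℕ) (degree≤Δ : ∀ w → degree G w ≤ Δ) where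

    count-sphere-suc-suc≤ : ∀ l → count (sphere (2 + l)) ≤ (Δ ∸ 1) * count (sphere (suc l))
    count-sphere-suc-suc≤ l = begin
      count (sphere (2 + l))                                  ≤⟨ count-sphere-suc≤ (suc l) ⟩
      sum (λ w → 𝟙 (sphere (suc l) w) * outDegree (suc l) w) ≤⟨ sum-mono-≤ weight≤ ⟩
      sum (λ w → (Δ ∸ 1) * 𝟙 (sphere (suc l) w))
        ≡⟨ *-distribˡ-sum (Δ ∸ 1) (λ w → 𝟙 (sphere (suc l) w)) ⟨
      (Δ ∸ 1) * count (sphere (suc l))                        ∎
      where
      open ≤-Reasoning
      weight≤ : ∀ w → 𝟙 (sphere (suc l) w) * outDegree (suc l) w ≤ (Δ ∸ 1) * 𝟙 (sphere (suc l) w)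
      weight≤ w with sphere (suc l) w in w∈S
      ... | false = z≤n
      ... | true  = subst₂ _≤_ (sym (*-identityˡ _)) (sym (*-identityʳ _))
                      (m+n≤o⇒m≤o∸n _ (≤-trans (outDegree-sphere l w∈S) (degree≤Δ w)))

    count-sphere≤ : ∀ l → count (sphere (suc l)) ≤ degree G v * (Δ ∸ 1) ^ l
    count-sphere≤ zero    = ≤-trans count-sphere-one≤ (≤-reflexive (sym (*-identityʳ _)))
    count-sphere≤ (suc l) = begin
      count (sphere (2 + l))               ≤⟨ count-sphere-suc-suc≤ l ⟩
      (Δ ∸ 1) * count (sphere (suc l))     ≤⟨ *-monoʳ-≤ (Δ ∸ 1) (count-sphere≤ l) ⟩
      (Δ ∸ 1) * (degree G v * (Δ ∸ 1) ^ l) ≡⟨ x∙yz≈y∙xz (Δ ∸ 1) (degree G v) _ ⟩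
      degree G v * (Δ ∸ 1) ^ suc l         ∎
      where open ≤-Reasoning

    count-ball-suc≤ : 2 ≤ Δ ∸ 1 → ∀ l → count (ball (suc l)) ≤ 2 * degree G v * (Δ ∸ 1) ^ l + 1
    count-ball-suc≤ r≥2 zero = begin
      count (ball 1)                 ≡⟨ count-ball-suc 0 ⟩
      count (ball 0) + count (sphere 1) ≡⟨ cong (_+ count (sphere 1)) count-ball-zero ⟩
      1 + count (sphere 1)           ≤⟨ +-monoʳ-≤ 1 count-sphere-one≤ ⟩
      1 + d                          ≡⟨ +-comm 1 d ⟩
      d + 1                          ≤⟨ +-monoˡ-≤ 1 (m≤m+n d (d + 0)) ⟩
      2 * d + 1                      ≡⟨ cong (_+ 1) (*-identityʳ (2 * d)) ⟨
      2 * d * 1 + 1                  ∎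
      where
      open ≤-Reasoning
      d = degree G v
    count-ball-suc≤ r≥2 (suc l) = begin
      count (ball (2 + l))                                  ≡⟨ count-ball-suc (suc l) ⟩
      count (ball (suc l)) + count (sphere (2 + l))         ≤⟨ +-mono-≤ (count-ball-suc≤ r≥2 l) (count-sphere≤ (suc l)) ⟩
      (2 * d * x + 1) + d * (r * x)                          ≤⟨ +-monoˡ-≤ (d * (r * x)) (+-monoˡ-≤ 1 doubling) ⟩
      (d * (r * x) + 1) + d * (r * x)                        ≡⟨ double+1 (d * (r * x)) ⟩
      2 * (d * (r * x)) + 1                                  ≡⟨ cong (_+ 1) (*-assoc 2 d (r * x)) ⟨
      2 * d * (r * x) + 1                                    ∎
      where
      open ≤-Reasoning
      d = degree G v
      r = Δ ∸ 1
      x = r ^ l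
      double+1 : ∀ y → (y + 1) + y ≡ 2 * y + 1
      double+1 = solve-∀
      doubling : 2 * d * x ≤ d * (r * x)
      doubling = begin
        2 * d * x   ≡⟨ *-assoc 2 d x ⟩
        2 * (d * x) ≡⟨ x∙yz≈y∙xz 2 d x ⟩
        d * (2 * x) ≤⟨ *-monoʳ-≤ d (*-monoˡ-≤ x r≥2) ⟩
        d * (r * x) ∎

    order≤ : 2 ≤ Δ ∸ 1 → ∀ k → (∀ u → DistLe G u v k) → n ≤ 2 * degree G v * (Δ ∸ 1) ^ (k ∸ 1) + 1
    order≤ r≥2 k within = ≤-trans (≤-reflexive (sym (count-total (λ u → distLe⇒ball (within u)))))
                                  (count-ball≤ k)
      where
      count-ball≤ : ∀ k → count (ball k) ≤ 2 * degree G v * (Δ ∸ 1) ^ (k ∸ 1) + 1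
      count-ball≤ zero    = ≤-trans (≤-reflexive count-ball-zero) (m≤n+m 1 _)
      count-ball≤ (suc l) = count-ball-suc≤ r≥2 l

module Averaging where

  open import Data.Nat
  open import Data.Nat.Properties
  open import Relation.Binary.PropositionalEquality
  open Counting

  order²≤ : ∀ {n} (G : Graph n) R → (∀ v → n ≤ 2 * degree G v * R + 1) →
               n * n ≤ 2 * degreeSum G * R + n
  order²≤ {n} G R order≤ = begin
    n * n                                             ≡⟨ sum-const n n ⟨
    sum {n} (λ _ → n)                                 ≤⟨ sum-mono-≤ order≤ ⟩
    sum {n} (λ v → 2 * degree G v * R + 1)            ≡⟨ ∑-distrib-+ (λ v → 2 * degree G v * R) (λ _ → 1) ⟩
    sum (λ v → 2 * degree G v * R) + sum {n} (λ _ → 1) ≡⟨ cong₂ _+_ sum-degrees (trans (sum-const n 1) (*-identityʳ n)) ⟩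
    2 * degreeSum G * R + n                           ∎
    where
    open ≤-Reasoning
    sum-degrees : sum (λ v → 2 * degree G v * R) ≡ 2 * degreeSum G * R
    sum-degrees = begin-equality
      sum (λ v → 2 * degree G v * R)  ≡⟨ *-distribʳ-sum R (λ v → 2 * degree G v) ⟨
      sum (λ v → 2 * degree G v) * R  ≡⟨ cong (_* R) (*-distribˡ-sum 2 (degree G)) ⟨
      2 * sum (degree G) * R          ≡⟨ cong (λ s → 2 * s * R) (sum-allFin (degree G)) ⟨
      2 * degreeSum G * R             ∎

open import Data.Nat using (ℕ; _≤_; _∸_; _^_; NonZero)
open import Data.Integer using (+_)
open import Data.Rational.Unnormalised using (ℚᵘ; _+_; _*_) renaming (_≤_ to _≤ℚ_)
open import Data.Rational.Unnormalised using (_/_)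

import Data.Nat as ℕ
import Data.Nat.Properties as ℕ
import Data.Integer as ℤ
import Data.Integer.Properties as ℤ
open import Data.Product using (_,_)
open import Data.Rational.Unnormalised using (mkℚᵘ; *≤*)
open import Relation.Binary.PropositionalEquality

square≤⇒≤ℚ : ∀ n .{{_ : NonZero n}} S R → n ℕ.* n ≤ 2 ℕ.* S ℕ.* R ℕ.+ n →
             (+ n / 1) ≤ℚ ((+ 2 / 1) * (+ S / n) * (+ R / 1) + (+ 1 / 1))
square≤⇒≤ℚ n@(ℕ.suc m) S R n²≤ = subst ((+ n / 1) ≤ℚ_) (sym rhs≡)
  (*≤* (subst₂ ℤ._≤_ (ℤ.pos-* n n) (sym (ℤ.*-identityʳ _)) (ℤ.+≤+ n²≤)))
  where
  open ≡-Reasoning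
  -- mkℚᵘ p m is the fraction p / (m + 1).
  rhs≡ : (+ 2 / 1) * (+ S / n) * (+ R / 1) + (+ 1 / 1) ≡ mkℚᵘ (+ (2 ℕ.* S ℕ.* R ℕ.+ n)) m
  rhs≡ = begin
    (+ 2 / 1) * (+ S / n) * (+ R / 1) + (+ 1 / 1)
      ≡⟨ cong (λ q → q * (+ R / 1) + (+ 1 / 1)) (cong₂ mkℚᵘ (sym (ℤ.pos-* 2 S)) (ℕ.+-identityʳ m)) ⟩
    mkℚᵘ (+ (2 ℕ.* S)) m * (+ R / 1) + (+ 1 / 1)
      ≡⟨ cong (_+ (+ 1 / 1)) (cong₂ mkℚᵘ (sym (ℤ.pos-* (2 ℕ.* S) R)) (ℕ.*-identityʳ m)) ⟩
    mkℚᵘ (+ (2 ℕ.* S ℕ.* R)) m + (+ 1 / 1)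
      ≡⟨ cong₂ mkℚᵘ numerator≡ (ℕ.*-identityʳ m) ⟩
    mkℚᵘ (+ (2 ℕ.* S ℕ.* R ℕ.+ n)) m
      ∎
    where
    numerator≡ : + (2 ℕ.* S ℕ.* R) ℤ.* + 1 ℤ.+ + 1 ℤ.* + n ≡ + (2 ℕ.* S ℕ.* R ℕ.+ n)
    numerator≡ = trans (cong₂ ℤ._+_ (ℤ.*-identityʳ (+ (2 ℕ.* S ℕ.* R))) (ℤ.*-identityˡ (+ n)))
                       (sym (ℤ.pos-+ (2 ℕ.* S ℕ.* R) n))

mainTheorem5 : (n : ℕ) .{{_ : NonZero n}} (G : Graph n) (Δ k : ℕ) →
    IsMaxDegree G Δ → 3 ≤ Δ → IsDiameter G k →
    ((+ n) / 1) ≤ℚ (((+ 2) / 1) * averageDegree G * ((+ ((Δ ∸ 1) ^ (k ∸ 1))) / 1) + ((+ 1) / 1))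
mainTheorem5 n G Δ k (degree≤Δ , _) 3≤Δ (within , _) =
  square≤⇒≤ℚ n (degreeSum G) ((Δ ∸ 1) ^ (k ∸ 1)) (Averaging.order²≤ G _ order≤)
  where
  order≤ : ∀ v → n ≤ 2 ℕ.* degree G v ℕ.* (Δ ∸ 1) ^ (k ∸ 1) ℕ.+ 1
  order≤ v = Balls.order≤ G v Δ degree≤Δ (ℕ.∸-monoˡ-≤ 1 3≤Δ) k (λ u → within u v)
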